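{- If $H$ is any induced subgraph of a finite simple graph $G$ and $k$ is a positive integer, then $\mathrm{MOF}_k(G) \geq \mathrm{MOF}_k(H)$.
   Context: An orientation $D$ of a simple graph $G$ assigns to each edge exactly one direction; if $(u,v)$ is an arc, $v$ is an out-neighbor of $u$. Oriented $k$-forcing: starting from a nonempty set $S$ of colored vertices, repeatedly, any colored vertex having at most $k$ non-colored out-neighbors forces all of them to become colored (all forcings in a step simultaneous), until no change occurs; $S$ is a $k$-forcing set if all vertices end up colored. $F_k(D)$ is the minimum size of a $k$-forcing set of $D$, and $\mathrm{MOF}_k(G)$ is the maximum of $F_k(D)$ over all orientations $D$ of $G$. -}

module Defs where

open import Data.Nat using (ℕ; zero; suc; _≤_)
open import Data.Bool using (Bool; true; false; _∧_; _∨_; not)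
open import Data.Fin using (Fin)
open import Data.List using (List; allFin; filter; length)
open import Data.Bool.ListAction using (any)
open import Data.Product using (_×_; Σ; ∃; ∃-syntax)
open import Data.Sum using (_⊎_)
open import Data.Bool.Properties using (T?)
open import Relation.Binary.PropositionalEquality using (_≡_)

record Graph (n : ℕ) : Set where
  field
    adj : Fin n → Fin n → Bool
    adj-sym : ∀ u v → adj u v ≡ adj v u
    adj-irr : ∀ v → adj v v ≡ false

open Graph public

-- An orientation of G: every edge gets exactly one direction, and arcs
-- only join adjacent vertices.  arc u v ≡ true means (u , v) is an arc.
record Orientation {n : ℕ} (G : Graph n) : Set where
  field
    arc : Fin n → Fin n → Bool
    arc-edge : ∀ u v → arc u v ≡ true → adj G u v ≡ true
    one-dir : ∀ u v → adj G u v ≡ true →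
              (arc u v ≡ true × arc v u ≡ false) ⊎ (arc u v ≡ false × arc v u ≡ true)

open Orientation public

VSet : ℕ → Set
VSet n = Fin n → Bool

size : ∀ {n} → VSet n → ℕ
size {n} S = length (filter (λ v → T? (S v)) (allFin n))

uncoloredOut : ∀ {n} {G : Graph n} → Orientation G → VSet n → Fin n → ℕ
uncoloredOut {n} D C u = length (filter (λ v → T? (arc D u v ∧ not (C v))) (allFin n))

canForce : ∀ {n} {G : Graph n} → Orientation G → ℕ → VSet n → Fin n → Set
canForce D k C u = (C u ≡ true) × (uncoloredOut D C u ≤ k)

open import Relation.Nullary using (Dec; yes; no)
open import Relation.Nullary.Decidable using (_×-dec_; ⌊_⌋)
open import Data.Nat using (_≤?_)
open import Data.Bool using (_≟_)

canForce? : ∀ {n} {G : Graph n} (D : Orientation G) k C u → Dec (canForce D k C u)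
canForce? D k C u = (C u ≟ true) ×-dec (uncoloredOut D C u ≤? k)

step : ∀ {n} {G : Graph n} → Orientation G → ℕ → VSet n → VSet n
step {n} D k C v = C v ∨ any (λ u → ⌊ canForce? D k C u ⌋ ∧ arc D u v) (allFin n)

iterate : ∀ {n} {G : Graph n} → Orientation G → ℕ → ℕ → VSet n → VSet n
iterate D k zero C = C
iterate D k (suc t) C = iterate D k t (step D k C)

-- S is a k-forcing set of D: S nonempty and after finitely many steps all
-- vertices are colored.  (The process is monotone, so once every vertex is
-- colored it stays so; "until no change occurs" is thus equivalent.)
IsForcingSet : ∀ {n} {G : Graph n} → Orientation G → ℕ → VSet n → Set
IsForcingSet {n} D k S =
  (∃[ v ] S v ≡ true) × (∃[ t ] (∀ v → iterate D k t S v ≡ true))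

IsFk : ∀ {n} {G : Graph n} → Orientation G → ℕ → ℕ → Set
IsFk {n} D k m =
  (∃[ S ] (IsForcingSet D k S × size S ≡ m)) ×
  (∀ (S : VSet n) → IsForcingSet D k S → m ≤ size S)

IsMOF : ∀ {n} → Graph n → ℕ → ℕ → Set
IsMOF G k m =
  (∃[ D ] IsFk {G = G} D k m) ×
  (∀ (D : Orientation G) (m' : ℕ) → IsFk D k m' → m' ≤ m)

InducedSubgraph : ∀ {m n} → Graph m → Graph n → Set
InducedSubgraph {m} {n} H G =
  Σ (Fin m → Fin n) λ f →
    (∀ i j → f i ≡ f j → i ≡ j) × (∀ i j → adj H i j ≡ adj G (f i) (f j))

-- Take an orientation DH of H attaining MOF_k(H) and extend it to an orientation D of G
-- in which every edge between H and the rest of G points away from H.  No vertex outside H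
-- can then force a vertex of H, and a vertex of H has at least as many uncoloured
-- out-neighbours in D as in DH.  Hence the forcing process of D, restricted to H, is
-- dominated by the forcing process of DH started from the restricted set, so every
-- k-forcing set of D meets H in a k-forcing set of DH, and
-- MOF_k(G) ≥ F_k(D) ≥ F_k(DH) = MOF_k(H).  The minimum defining F_k(D) is only obtained
-- under double negation, which is enough since the conclusion is a decidable inequality.
module Submission where

open import Defs
open import Data.Bool using (Bool; true; false; T; _∧_; _∨_; not)
open import Data.Bool.Properties using (T?; T-≡; ∧-zeroʳ; ∧-identityʳ)
open import Data.Bool.ListAction using (any)
open import Data.Empty using (⊥-elim)
open import Data.Fin using (Fin) renaming (_≟_ to _≟ᶠ_)
open import Data.Fin.Properties using (any?)
open import Data.List using (List; []; _∷_; allFin; filter; length; map)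
open import Data.List.Properties using (length-map)
open import Data.List.Membership.Propositional using (_∈_; lose)
open import Data.List.Membership.Propositional.Properties
  using (∈-filter⁺; ∈-filter⁻; ∈-map⁻; ∈-allFin)
open import Data.List.Relation.Binary.Subset.Propositional using (_⊆_)
open import Data.List.Relation.Unary.All using () renaming (lookup to All-lookup)
open import Data.List.Relation.Unary.AllPairs.Core using (_∷_)
open import Data.List.Relation.Unary.Any using (here; there; satisfied)
open import Data.List.Relation.Unary.Any.Properties using (any⁺; any⁻)
open import Data.List.Relation.Unary.Unique.Propositional using (Unique)
import Data.List.Relation.Unary.Unique.Propositional.Properties as Unique
open import Data.Nat using (ℕ; zero; suc; _≤_; _<_; s≤s; z≤n; _≤?_)
open import Data.Nat.Induction using (<-rec)
open import Data.Nat.Properties using (≤-trans; ≰⇒>; module ≤-Reasoning)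
open import Data.Product using (_×_; ∃; ∃-syntax; _,_; proj₁; proj₂)
open import Data.Sum using (_⊎_; inj₁; inj₂)
open import Function using (_∘_; Injective)
open import Function.Bundles using (Equivalence)
open import Relation.Binary.PropositionalEquality using (_≡_; _≢_; refl; sym; trans; cong; subst)
open import Relation.Nullary using (Dec; yes; no; ¬_)
open import Relation.Nullary.Decidable using (⌊_⌋; decidable-stable)

open Equivalence using (to; from)

∧-≡-true⁻ : ∀ {a b} → a ∧ b ≡ true → a ≡ true × b ≡ true
∧-≡-true⁻ {true} b≡true = refl , b≡true

∧-≡-true⁺ : ∀ {a b} → a ≡ true → b ≡ true → a ∧ b ≡ true
∧-≡-true⁺ refl b≡true = b≡true

∨-≡-true⁻ : ∀ {a b} → a ∨ b ≡ true → a ≡ true ⊎ b ≡ true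
∨-≡-true⁻ {true}  _      = inj₁ refl
∨-≡-true⁻ {false} b≡true = inj₂ b≡true

∨-≡-trueˡ : ∀ {a} b → a ≡ true → a ∨ b ≡ true
∨-≡-trueˡ _ refl = refl

∨-≡-trueʳ : ∀ a {b} → b ≡ true → a ∨ b ≡ true
∨-≡-trueʳ true  _      = refl
∨-≡-trueʳ false b≡true = b≡true

not-antitone : ∀ {a b} → (a ≡ true → b ≡ true) → not b ≡ true → not a ≡ true
not-antitone {false}         _   _ = refl
not-antitone {true}  {false} a⇒b _ = a⇒b refl
not-antitone {true}  {true}  _   ()

⌊⌋-≡-true⁻ : ∀ {A : Set} (a? : Dec A) → ⌊ a? ⌋ ≡ true → A
⌊⌋-≡-true⁻ (yes a) _ = a

⌊⌋-≡-true⁺ : ∀ {A : Set} (a? : Dec A) → A → ⌊ a? ⌋ ≡ true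
⌊⌋-≡-true⁺ (yes _) _ = refl
⌊⌋-≡-true⁺ (no ¬a) a = ⊥-elim (¬a a)

any-allFin⁺ : ∀ {n} (p : Fin n → Bool) v → p v ≡ true → any p (allFin n) ≡ true
any-allFin⁺ p v pv = to T-≡ (any⁺ p (lose {P = T ∘ p} (∈-allFin v) (from T-≡ pv)))

any-allFin⁻ : ∀ {n} (p : Fin n → Bool) → any p (allFin n) ≡ true → ∃[ v ] p v ≡ true
any-allFin⁻ {n} p any≡true with satisfied (any⁻ p (allFin n) (from T-≡ any≡true))
... | v , pv = v , to T-≡ pv

delete-∈ : ∀ {A : Set} {x : A} {ys : List A} → x ∈ ys →
  ∃[ zs ] (length ys ≡ suc (length zs) × (∀ {y} → y ∈ ys → y ≢ x → y ∈ zs))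
delete-∈ {ys = _ ∷ ys} (here refl) =
  ys , refl , λ { (here y≡x) y≢x → ⊥-elim (y≢x y≡x) ; (there y∈ys) _ → y∈ys }
delete-∈ {ys = y ∷ _} (there x∈ys) with delete-∈ x∈ys
... | zs , |ys|≡ , keep =
  y ∷ zs , cong suc |ys|≡ ,
  λ { (here refl) _ → here refl ; (there z∈ys) z≢x → there (keep z∈ys z≢x) }

Unique-⊆⇒length≤ : ∀ {A : Set} {xs ys : List A} → Unique xs → xs ⊆ ys → length xs ≤ length ys
Unique-⊆⇒length≤ {xs = []}     _            _      = z≤n
Unique-⊆⇒length≤ {xs = x ∷ xs} (x∉xs ∷ uxs) xs⊆ys with delete-∈ (xs⊆ys (here refl))
... | zs , |ys|≡ , keep =
  subst (suc (length xs) ≤_) (sym |ys|≡) (s≤s (Unique-⊆⇒length≤ uxs xs⊆zs))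
  where
  xs⊆zs : xs ⊆ zs
  xs⊆zs y∈xs = keep (xs⊆ys (there y∈xs)) (λ y≡x → All-lookup x∉xs y∈xs (sym y≡x))

size-mono-injective : ∀ {m n} {f : Fin m → Fin n} → Injective _≡_ _≡_ f →
  {P : VSet m} {Q : VSet n} → (∀ i → P i ≡ true → Q (f i) ≡ true) → size P ≤ size Q
size-mono-injective {m} {n} {f} f-injective {P} {Q} P⇒Q∘f = begin
  size P            ≡⟨ sym (length-map f Ps) ⟩
  length (map f Ps) ≤⟨ Unique-⊆⇒length≤ (Unique.map⁺ f-injective Ps-unique) f[Ps]⊆Qs ⟩
  size Q            ∎
  where
  open ≤-Reasoning
  Ps = filter (λ i → T? (P i)) (allFin m)
  Ps-unique : Unique Ps
  Ps-unique = Unique.filter⁺ (λ i → T? (P i)) (Unique.allFin⁺ m)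
  f[Ps]⊆Qs : map f Ps ⊆ filter (λ v → T? (Q v)) (allFin n)
  f[Ps]⊆Qs v∈f[Ps] with ∈-map⁻ f v∈f[Ps]
  ... | i , i∈Ps , refl =
    ∈-filter⁺ (λ v → T? (Q v)) (∈-allFin (f i))
      (from T-≡ (P⇒Q∘f i (to T-≡ (proj₂ (∈-filter⁻ (λ i → T? (P i)) {xs = allFin m} i∈Ps)))))

Least : (ℕ → Set) → Set
Least P = ∃[ y ] (P y × ∀ z → P z → y ≤ z)

¬¬-least : (P : ℕ → Set) → ∀ x → P x → ¬ ¬ Least P
¬¬-least P = <-rec (λ x → P x → ¬ ¬ Least P)
  λ x smaller Px noLeast → noLeast (x , Px , below smaller noLeast)
  where
  below : ∀ {x} → (∀ {y} → y < x → P y → ¬ ¬ Least P) → ¬ Least P → ∀ z → P z → x ≤ z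
  below {x} smaller noLeast z Pz with x ≤? z
  ... | yes x≤z = x≤z
  ... | no  x≰z = ⊥-elim (smaller (≰⇒> x≰z) Pz noLeast)

module _ {n} {G : Graph n} (D : Orientation G) (k : ℕ) where

  step-colored⇒colored : ∀ C v → step D k C v ≡ true → ∃[ u ] C u ≡ true
  step-colored⇒colored C v stepped with ∨-≡-true⁻ {C v} stepped
  ... | inj₁ Cv     = v , Cv
  ... | inj₂ forced with any-allFin⁻ _ forced
  ... | u , u-forces = u , proj₁ (⌊⌋-≡-true⁻ (canForce? D k C u) (proj₁ (∧-≡-true⁻ u-forces)))

  iterate-colored⇒colored : ∀ t C v → iterate D k t C v ≡ true → ∃[ u ] C u ≡ true
  iterate-colored⇒colored zero    C v Cv      = v , Cv
  iterate-colored⇒colored (suc t) C v colored with iterate-colored⇒colored t (step D k C) v colored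
  ... | u , stepped = step-colored⇒colored C u stepped

  ¬¬-Fk : Fin n → ¬ ¬ ∃ (IsFk D k)
  ¬¬-Fk v noFk = ¬¬-least Attained (size everything) (everything , everything-forces , refl)
    λ (x , attained , least) → noFk (x , attained , λ S forces → least (size S) (S , forces , refl))
    where
    Attained : ℕ → Set
    Attained x = ∃[ S ] (IsForcingSet D k S × size S ≡ x)
    everything : VSet n
    everything _ = true
    everything-forces : IsForcingSet D k everything
    everything-forces = (v , refl) , 0 , λ _ → refl

module Extension {m n} {G : Graph n} {H : Graph m} (f : Fin m → Fin n)
  (f-injective : Injective _≡_ _≡_ f) (f-adj : ∀ i j → adj H i j ≡ adj G (f i) (f j))
  (DH : Orientation H) (D₀ : Orientation G) where

  Fibre : Fin n → Set
  Fibre u = ∃[ i ] f i ≡ u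

  fibre? : ∀ u → Dec (Fibre u)
  fibre? u = any? (λ i → f i ≟ᶠ u)

  direction : ∀ u v → Dec (Fibre u) → Dec (Fibre v) → Bool
  direction u v (yes (i , _)) (yes (j , _)) = arc DH i j
  direction u v (yes _)       (no _)        = true
  direction u v (no _)        (yes _)       = false
  direction u v (no _)        (no _)        = arc D₀ u v

  direction-one-way : ∀ u v → adj G u v ≡ true → ∀ u? v? →
    (direction u v u? v? ≡ true × direction v u v? u? ≡ false) ⊎
    (direction u v u? v? ≡ false × direction v u v? u? ≡ true)
  direction-one-way u v uv (yes (i , refl)) (yes (j , refl)) = one-dir DH i j (trans (f-adj i j) uv)
  direction-one-way u v uv (yes _)          (no _)           = inj₁ (refl , refl)
  direction-one-way u v uv (no _)           (yes _)          = inj₂ (refl , refl)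
  direction-one-way u v uv (no _)           (no _)           = one-dir D₀ u v uv

  extArc : Fin n → Fin n → Bool
  extArc u v = adj G u v ∧ direction u v (fibre? u) (fibre? v)

  extend : Orientation G
  extend = record
    { arc      = extArc
    ; arc-edge = λ u v → proj₁ ∘ ∧-≡-true⁻
    ; one-dir  = one-dir-extend
    }
    where
    one-dir-extend : ∀ u v → adj G u v ≡ true →
      (extArc u v ≡ true × extArc v u ≡ false) ⊎ (extArc u v ≡ false × extArc v u ≡ true)
    one-dir-extend u v uv rewrite uv | sym (adj-sym G u v) | uv =
      direction-one-way u v uv (fibre? u) (fibre? v)

  direction-image : ∀ i j i? j? → direction (f i) (f j) i? j? ≡ arc DH i j
  direction-image i j (yes (i′ , fi′≡fi)) (yes (j′ , fj′≡fj))
    rewrite f-injective fi′≡fi | f-injective fj′≡fj = refl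
  direction-image i j (yes _) (no ∉) = ⊥-elim (∉ (j , refl))
  direction-image i j (no ∉)  _      = ⊥-elim (∉ (i , refl))

  extend-image : ∀ i j → arc extend (f i) (f j) ≡ arc DH i j
  extend-image i j rewrite direction-image i j (fibre? (f i)) (fibre? (f j)) with arc DH i j in ij
  ... | false = ∧-zeroʳ _
  ... | true  = trans (∧-identityʳ _) (trans (sym (f-adj i j)) (arc-edge DH i j ij))

  direction-into-image : ∀ u j u? j? → direction u (f j) u? j? ≡ true → Fibre u
  direction-into-image u j (yes fibre) _        _  = fibre
  direction-into-image u j (no _)      (yes _)  ()
  direction-into-image u j (no _)      (no ∉)   _  = ⊥-elim (∉ (j , refl))

  extend-into-image : ∀ u j → arc extend u (f j) ≡ true → Fibre u
  extend-into-image u j uj =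
    direction-into-image u j (fibre? u) (fibre? (f j)) (proj₂ (∧-≡-true⁻ {adj G u (f j)} uj))

  _⊆ᶠ_ : VSet n → VSet m → Set
  CG ⊆ᶠ CH = ∀ j → CG (f j) ≡ true → CH j ≡ true

  module _ (k : ℕ) where

    uncoloredOut-image : ∀ {CG CH} → CG ⊆ᶠ CH → ∀ i →
      uncoloredOut DH CH i ≤ uncoloredOut extend CG (f i)
    uncoloredOut-image {CG} {CH} CG⊆CH i = size-mono-injective f-injective uncolored
      where
      uncolored : ∀ j → arc DH i j ∧ not (CH j) ≡ true →
                  arc extend (f i) (f j) ∧ not (CG (f j)) ≡ true
      uncolored j rewrite extend-image i j with arc DH i j
      ... | true  = not-antitone (CG⊆CH j)
      ... | false = λ ()

    canForce-image : ∀ {CG CH} → CG ⊆ᶠ CH → ∀ i → canForce extend k CG (f i) → canForce DH k CH i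
    canForce-image CG⊆CH i (colored , few) =
      CG⊆CH i colored , ≤-trans (uncoloredOut-image CG⊆CH i) few

    step-⊆ᶠ : ∀ {CG CH} → CG ⊆ᶠ CH → step extend k CG ⊆ᶠ step DH k CH
    step-⊆ᶠ {CG} {CH} CG⊆CH j stepped with ∨-≡-true⁻ {CG (f j)} stepped
    ... | inj₁ colored = ∨-≡-trueˡ _ (CG⊆CH j colored)
    ... | inj₂ forced  with any-allFin⁻ _ forced
    ... | u , u-forces with ∧-≡-true⁻ {⌊ canForce? extend k CG u ⌋} u-forces
    ... | u-can , uj with extend-into-image u j uj
    ... | i , refl =
      ∨-≡-trueʳ (CH j) (any-allFin⁺ _ i (∧-≡-true⁺ can (trans (sym (extend-image i j)) uj)))
      where
      can : ⌊ canForce? DH k CH i ⌋ ≡ true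
      can = ⌊⌋-≡-true⁺ (canForce? DH k CH i)
              (canForce-image CG⊆CH i (⌊⌋-≡-true⁻ (canForce? extend k CG (f i)) u-can))

    iterate-⊆ᶠ : ∀ t {CG CH} → CG ⊆ᶠ CH → iterate extend k t CG ⊆ᶠ iterate DH k t CH
    iterate-⊆ᶠ zero    CG⊆CH = CG⊆CH
    iterate-⊆ᶠ (suc t) {CG} {CH} CG⊆CH = iterate-⊆ᶠ t (step-⊆ᶠ {CG} {CH} CG⊆CH)

    restrict-forcing : Fin m → ∀ S → IsForcingSet extend k S → IsForcingSet DH k (S ∘ f)
    restrict-forcing i₀ S (_ , t , all-colored) =
      iterate-colored⇒colored DH k t (S ∘ f) i₀ (colored-in-H i₀) , t , colored-in-H
      where
      colored-in-H : ∀ i → iterate DH k t (S ∘ f) i ≡ true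
      colored-in-H i = iterate-⊆ᶠ t (λ _ Sfj → Sfj) i (all-colored (f i))

    Fk-≤-Fk-extend : ∀ {b x} → IsFk DH k b → IsFk extend k x → b ≤ x
    Fk-≤-Fk-extend ((_ , ((i₀ , _) , _) , _) , minimal) ((S , S-forces , refl) , _) =
      ≤-trans (minimal (S ∘ f) (restrict-forcing i₀ S S-forces))
              (size-mono-injective f-injective (λ _ Sfi → Sfi))

-- The bound holds for every k.
proposition3p11 : ∀ {m n : ℕ} (G : Graph n) (H : Graph m) (k : ℕ) → 1 ≤ k →
    InducedSubgraph H G → ∀ (a b : ℕ) → IsMOF G k a → IsMOF H k b → b ≤ a
proposition3p11 G H k _ (f , f-injective , f-adj) a b
                ((D₀ , _) , maximal) ((DH , FkH@((_ , ((i₀ , _) , _) , _) , _)) , _) =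
  decidable-stable (b ≤? a) λ b≰a →
    ¬¬-Fk extend k (f i₀) λ (x , Fk-extend) →
      b≰a (≤-trans (Fk-≤-Fk-extend k FkH Fk-extend) (maximal extend x Fk-extend))
  where
  open Extension f (λ {i} {j} → f-injective i j) f-adj DH D₀
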